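{- Let $n$ be the length of the source string, $t$ a positive integer (the number of traces), $0<\delta<1$ and $\rho=1-\delta$. Then $$L_{0,\mathrm{avg}}(n)\le L_{t,\mathrm{avg}}(\delta,n)\le L_{0,\mathrm{avg}}(n)+t\rho\cdot n.$$
   Context: For $x\in\{0,1\}^n$ and $0<\delta<1$, the deletion channel $\mathrm{Del}_\delta(x)$ is the distribution over $\{0,1\}^{\le n}$ obtained by independently deleting each bit of $x$ with probability $\delta$ and concatenating the surviving bits; a draw is a trace of $x$. $|\mathsf{LCS}(u,v)|$ denotes the length of a longest common subsequence of $u,v$. Define $L_{0,\mathrm{avg}}(n):=\max_{z\in\{0,1\}^n}\mathbb{E}_{x\sim\{0,1\}^n}[|\mathsf{LCS}(x,z)|]$ with $x$ uniform, and for $t\ge1$, $L_{t,\mathrm{avg}}(\delta,n):=\max_A\mathbb{E}_{x\sim\{0,1\}^n}\mathbb{E}_{y^{(1)},\dots,y^{(t)}\sim\mathrm{Del}_\delta(x)}[|\mathsf{LCS}(A(y^{(1)},\dots,y^{(t)},n),x)|]$, where $x$ is uniform, the $t$ traces are independent, and the maximum is over all algorithms $A$ that receive $n,\delta$ and the $t$ traces and output an $n$-bit string.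
   Formalization: The deletion probability δ is rational, with $0<\delta<1$. -}

module Defs where

open import Data.Bool using (Bool; true; false; if_then_else_)
import Data.Bool.Properties as BoolP
open import Data.Nat as ℕ using (ℕ; zero; suc)
open import Data.List using (List; []; _∷_; map; concatMap; length; filter; foldr; _++_)
open import Data.Vec as Vec using (Vec)
open import Data.Rational using (ℚ; 0ℚ; 1ℚ; ½; _+_; _*_; _-_; _⊔_)
import Data.Rational as Q
import Data.Integer as Int
open import Relation.Nullary.Decidable using (⌊_⌋)
open import Data.List.Relation.Binary.Sublist.DecPropositional BoolP._≟_ using (_⊆_; _⊆?_)

allStrings : ℕ → List (List Bool)
allStrings zero = [] ∷ []
allStrings (suc n) = concatMap (λ s → (false ∷ s) ∷ (true ∷ s) ∷ []) (allStrings n)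

subsequences : List Bool → List (List Bool)
subsequences [] = [] ∷ []
subsequences (b ∷ bs) = let r = subsequences bs in map (b ∷_) r ++ r

maxℕ : List ℕ → ℕ
maxℕ = foldr ℕ._⊔_ 0

lcsLen : List Bool → List Bool → ℕ
lcsLen u v = maxℕ (map length (filter (λ s → s ⊆? v) (subsequences u)))

fromℕ : ℕ → ℚ
fromℕ n = Int.+ n Q./ 1

sumℚ : List ℚ → ℚ
sumℚ = foldr _+_ 0ℚ

maxℚ : List ℚ → ℚ
maxℚ [] = 0ℚ
maxℚ (q ∷ qs) = foldr _⊔_ q qs

_^ℚ_ : ℚ → ℕ → ℚ
q ^ℚ zero = 1ℚ
q ^ℚ suc k = q * (q ^ℚ k)

avgOver : (n : ℕ) → (List Bool → ℚ) → ℚ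
avgOver n f = (½ ^ℚ n) * sumℚ (map f (allStrings n))

-- Deletion channel Del_δ: a mask m (true = bit kept, false = bit deleted),
-- of the same length as x, produces the trace of surviving bits
applyMask : List Bool → List Bool → List Bool
applyMask [] _ = []
applyMask (_ ∷ _) [] = []
applyMask (b ∷ x) (true ∷ m) = b ∷ applyMask x m
applyMask (_ ∷ x) (false ∷ m) = applyMask x m

maskProb : ℚ → List Bool → ℚ
maskProb δ [] = 1ℚ
maskProb δ (true ∷ m) = (1ℚ - δ) * maskProb δ m
maskProb δ (false ∷ m) = δ * maskProb δ m

allMaskTuples : (t n : ℕ) → List (Vec (List Bool) t)
allMaskTuples zero n = Vec.[] ∷ []
allMaskTuples (suc t) n =
  concatMap (λ m → map (m Vec.∷_) (allMaskTuples t n)) (allStrings n)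

tupleProb : {t : ℕ} → ℚ → Vec (List Bool) t → ℚ
tupleProb δ Vec.[] = 1ℚ
tupleProb δ (m Vec.∷ ms) = maskProb δ m * tupleProb δ ms

expTraces : (t n : ℕ) → ℚ → List Bool → (Vec (List Bool) t → ℚ) → ℚ
expTraces t n δ x f =
  sumℚ (map (λ ms → tupleProb δ ms * f (Vec.map (applyMask x) ms)) (allMaskTuples t n))

L0avg : ℕ → ℚ
L0avg n = maxℚ (map (λ z → avgOver n (λ x → fromℕ (lcsLen x z))) (allStrings n))

Algorithm : (t n : ℕ) → Set
Algorithm t n = Vec (List Bool) t → Vec Bool n

algValue : (t : ℕ) → ℚ → (n : ℕ) → Algorithm t n → ℚ
algValue t δ n A =
  avgOver n (λ x → expTraces t n δ x (λ ys → fromℕ (lcsLen (Vec.toList (A ys)) x)))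

{-# OPTIONS --safe #-}
-- Fix the t deletion masks and let S be the set of positions kept in at least one trace;
-- the output is then a function z of the bits of x on S.  Exchanging the bits on S between
-- x and an independent uniform w preserves the uniform measure on pairs.  The string
-- (w outside S, x on S) has the same output z x, while the target (x outside S, w on S)
-- differs from x in at most |S| positions, which costs at most |S| in the LCS.  After the
-- exchange the output and the target are independent, so the expected LCS is at most
-- L_{0,avg}(n).  Averaging |S| ≤ Σᵢ (bits kept in trace i) over the masks gives tρn.
-- The lower bound is the constant algorithm returning a maximiser of L_{0,avg}(n).
module Submission where

open import Defs
open import Data.Bool using (Bool; true; false; _∨_; if_then_else_)
import Data.Bool.Properties as BoolP
open import Data.Nat as ℕ using (ℕ; zero; suc; _≥_)
import Data.Nat.Properties as ℕP
open import Data.List using (List; []; _∷_; map; concatMap; length; filter; _++_)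
import Data.List.Properties as ListP
open import Data.List.Relation.Unary.All as All using (All; []; _∷_)
import Data.List.Relation.Unary.All.Properties as AllP
open import Data.List.Relation.Unary.Any as Any using (here; there)
open import Data.List.Membership.Propositional using (_∈_; find)
open import Data.List.Membership.Propositional.Properties
  using (∈-++⁺ˡ; ∈-++⁺ʳ; ∈-map⁺; ∈-map⁻; ∈-filter⁺; ∈-filter⁻; ∈-concatMap⁺; ∈-concatMap⁻;
         foldr-selective)
open import Data.List.Relation.Binary.Sublist.DecPropositional BoolP._≟_
  using (_⊆_; _⊆?_; []; _∷_; _∷ʳ_; ⊆-refl; ⊆-trans)
open import Data.Vec as Vec using (Vec)
import Data.Vec.Properties as VecP
import Data.Vec.Relation.Unary.All as VecAll
open import Data.Rational using (ℚ; 0ℚ; 1ℚ; ½; _+_; _*_; _-_; -_; _≤_; _<_; _⊔_)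
import Data.Rational as Q
import Data.Rational.Properties as QP
import Data.Rational.Unnormalised as ℚᵘ
import Data.Rational.Unnormalised.Properties as ℚᵘP
import Data.Integer as ℤ
import Data.Integer.Properties as ℤP
open import Data.Rational.Solver using (module +-*-Solver)
open +-*-Solver using (solve; _:+_; _:*_; _:-_; _:=_; con)
open import Data.Product using (Σ-syntax; ∃-syntax; _×_; _,_)
open import Data.Sum as Sum using (_⊎_; inj₂; [_,_]; [_,_]′)
open import Data.Unit using (⊤; tt)
open import Data.Empty using (⊥)
open import Relation.Binary.PropositionalEquality using (_≡_; refl; sym; trans; cong; cong₂; module ≡-Reasoning)

*-nonNeg : ∀ {p q} → 0ℚ ≤ p → 0ℚ ≤ q → 0ℚ ≤ p * q
*-nonNeg {p} {q} p≥0 q≥0 =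
  QP.nonNegative⁻¹ _ {{QP.nonNeg*nonNeg⇒nonNeg p {{Q.nonNegative p≥0}} q {{Q.nonNegative q≥0}}}}

fromℕ-+ : ∀ a b → fromℕ (a ℕ.+ b) ≡ fromℕ a + fromℕ b
fromℕ-+ a b = QP.toℚᵘ-injective (begin
  Q.toℚᵘ (fromℕ (a ℕ.+ b))               ≈⟨ QP.toℚᵘ-fromℚᵘ _ ⟩
  ℚᵘ.mkℚᵘ (ℤ.+ (a ℕ.+ b)) 0               ≈⟨ ℚᵘ.*≡* cross-multiplied ⟩
  ℚᵘ.mkℚᵘ (ℤ.+ a) 0 ℚᵘ.+ ℚᵘ.mkℚᵘ (ℤ.+ b) 0 ≈⟨ ℚᵘP.+-cong (QP.toℚᵘ-fromℚᵘ (ℚᵘ.mkℚᵘ (ℤ.+ a) 0))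
                                                          (QP.toℚᵘ-fromℚᵘ (ℚᵘ.mkℚᵘ (ℤ.+ b) 0)) ⟨
  Q.toℚᵘ (fromℕ a) ℚᵘ.+ Q.toℚᵘ (fromℕ b)  ≈⟨ QP.toℚᵘ-homo-+ (fromℕ a) (fromℕ b) ⟨
  Q.toℚᵘ (fromℕ a + fromℕ b)              ∎)
  where
  open ℚᵘP.≃-Reasoning
  cross-multiplied : ℤ.+ (a ℕ.+ b) ℤ.* ℤ.+ 1 ≡ (ℤ.+ a ℤ.* ℤ.+ 1 ℤ.+ ℤ.+ b ℤ.* ℤ.+ 1) ℤ.* ℤ.+ 1
  cross-multiplied rewrite ℤP.*-identityʳ (ℤ.+ a) | ℤP.*-identityʳ (ℤ.+ b) = cong (ℤ._* ℤ.+ 1) (ℤP.pos-+ a b)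

fromℕ-nonNeg : ∀ n → 0ℚ ≤ fromℕ n
fromℕ-nonNeg n = QP.nonNegative⁻¹ (fromℕ n) {{QP.normalize-nonNeg n 1}}

fromℕ-mono : ∀ {a b} → a ℕ.≤ b → fromℕ a ≤ fromℕ b
fromℕ-mono {a} a≤b with ℕP.m≤n⇒∃[o]m+o≡n a≤b
... | k , refl = begin
  fromℕ a           ≡⟨ QP.+-identityʳ (fromℕ a) ⟨
  fromℕ a + 0ℚ      ≤⟨ QP.+-monoʳ-≤ (fromℕ a) (fromℕ-nonNeg k) ⟩
  fromℕ a + fromℕ k ≡⟨ fromℕ-+ a k ⟨
  fromℕ (a ℕ.+ k)   ∎
  where open QP.≤-Reasoning

-- Finite sums and expectations

∑ : {A : Set} → List A → (A → ℚ) → ℚ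
∑ l f = sumℚ (map f l)

∑-cong : {A : Set} (l : List A) {f g : A → ℚ} → (∀ a → f a ≡ g a) → ∑ l f ≡ ∑ l g
∑-cong []      f≗g = refl
∑-cong (a ∷ l) f≗g = cong₂ _+_ (f≗g a) (∑-cong l f≗g)

∑-mono : {A : Set} (l : List A) {f g : A → ℚ} → (∀ a → a ∈ l → f a ≤ g a) → ∑ l f ≤ ∑ l g
∑-mono []      f≤g = QP.≤-refl
∑-mono (a ∷ l) f≤g = QP.+-mono-≤ (f≤g a (here refl)) (∑-mono l (λ b b∈l → f≤g b (there b∈l)))

∑-++ : {A : Set} (l₁ l₂ : List A) (f : A → ℚ) → ∑ (l₁ ++ l₂) f ≡ ∑ l₁ f + ∑ l₂ f
∑-++ []       l₂ f = sym (QP.+-identityˡ _)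
∑-++ (a ∷ l₁) l₂ f = trans (cong (f a +_) (∑-++ l₁ l₂ f)) (sym (QP.+-assoc (f a) _ _))

∑-concatMap : {A B : Set} (g : A → List B) (l : List A) (f : B → ℚ) →
  ∑ (concatMap g l) f ≡ ∑ l (λ a → ∑ (g a) f)
∑-concatMap g []      f = refl
∑-concatMap g (a ∷ l) f = trans (∑-++ (g a) _ f) (cong (∑ (g a) f +_) (∑-concatMap g l f))

∑-map : {A B : Set} (g : A → B) (l : List A) (f : B → ℚ) → ∑ (map g l) f ≡ ∑ l (λ a → f (g a))
∑-map g []      f = refl
∑-map g (a ∷ l) f = cong (f (g a) +_) (∑-map g l f)

∑-zero : {A : Set} (l : List A) → ∑ l (λ _ → 0ℚ) ≡ 0ℚ
∑-zero []      = refl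
∑-zero (a ∷ l) = trans (QP.+-identityˡ _) (∑-zero l)

∑-distrib-+ : {A : Set} (l : List A) (f g : A → ℚ) → ∑ l (λ a → f a + g a) ≡ ∑ l f + ∑ l g
∑-distrib-+ []      f g = refl
∑-distrib-+ (a ∷ l) f g = trans (cong (f a + g a +_) (∑-distrib-+ l f g))
  (solve 4 (λ x y z w → (x :+ y) :+ (z :+ w) := (x :+ z) :+ (y :+ w)) refl (f a) (g a) (∑ l f) (∑ l g))

*-distribˡ-∑ : {A : Set} (c : ℚ) (l : List A) (f : A → ℚ) → c * ∑ l f ≡ ∑ l (λ a → c * f a)
*-distribˡ-∑ c []      f = QP.*-zeroʳ c
*-distribˡ-∑ c (a ∷ l) f = trans (QP.*-distribˡ-+ c (f a) (∑ l f)) (cong (c * f a +_) (*-distribˡ-∑ c l f))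

*-distribʳ-∑ : {A : Set} (c : ℚ) (l : List A) (f : A → ℚ) → ∑ l f * c ≡ ∑ l (λ a → f a * c)
*-distribʳ-∑ c l f = trans (QP.*-comm (∑ l f) c)
  (trans (*-distribˡ-∑ c l f) (∑-cong l (λ a → QP.*-comm c (f a))))

∑-comm : {A B : Set} (l₁ : List A) (l₂ : List B) (f : A → B → ℚ) →
  ∑ l₁ (λ a → ∑ l₂ (f a)) ≡ ∑ l₂ (λ b → ∑ l₁ (λ a → f a b))
∑-comm []       l₂ f = sym (∑-zero l₂)
∑-comm (a ∷ l₁) l₂ f = trans (cong (∑ l₂ (f a) +_) (∑-comm l₁ l₂ f))
  (sym (∑-distrib-+ l₂ (f a) (λ b → ∑ l₁ (λ a′ → f a′ b))))

𝔼 : {A : Set} → List A → (A → ℚ) → (A → ℚ) → ℚ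
𝔼 l w f = ∑ l (λ a → w a * f a)

module _ {A : Set} (l : List A) (w : A → ℚ) where

  𝔼-cong : {f g : A → ℚ} → (∀ a → f a ≡ g a) → 𝔼 l w f ≡ 𝔼 l w g
  𝔼-cong f≗g = ∑-cong l (λ a → cong (w a *_) (f≗g a))

  𝔼-mono : (∀ a → 0ℚ ≤ w a) → {f g : A → ℚ} → (∀ a → a ∈ l → f a ≤ g a) → 𝔼 l w f ≤ 𝔼 l w g
  𝔼-mono w≥0 f≤g = ∑-mono l (λ a a∈l → QP.*-monoˡ-≤-nonNeg (w a) {{Q.nonNegative (w≥0 a)}} (f≤g a a∈l))

  𝔼-distrib-+ : (f g : A → ℚ) → 𝔼 l w (λ a → f a + g a) ≡ 𝔼 l w f + 𝔼 l w g
  𝔼-distrib-+ f g = trans (∑-cong l (λ a → QP.*-distribˡ-+ (w a) (f a) (g a))) (∑-distrib-+ l _ _)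

  𝔼-one : 𝔼 l w (λ _ → 1ℚ) ≡ ∑ l w
  𝔼-one = ∑-cong l (λ a → QP.*-identityʳ (w a))

  𝔼-const : ∑ l w ≡ 1ℚ → (c : ℚ) → 𝔼 l w (λ _ → c) ≡ c
  𝔼-const ∑w≡1 c = trans (sym (*-distribʳ-∑ c l w)) (trans (cong (_* c) ∑w≡1) (QP.*-identityˡ c))

  𝔼-+-const : ∑ l w ≡ 1ℚ → (f : A → ℚ) (c : ℚ) → 𝔼 l w (λ a → f a + c) ≡ 𝔼 l w f + c
  𝔼-+-const ∑w≡1 f c = trans (𝔼-distrib-+ f (λ _ → c)) (cong (𝔼 l w f +_) (𝔼-const ∑w≡1 c))

𝔼-comm : {A B : Set} (l₁ : List A) (w₁ : A → ℚ) (l₂ : List B) (w₂ : B → ℚ) (f : A → B → ℚ) →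
  𝔼 l₁ w₁ (λ a → 𝔼 l₂ w₂ (f a)) ≡ 𝔼 l₂ w₂ (λ b → 𝔼 l₁ w₁ (λ a → f a b))
𝔼-comm l₁ w₁ l₂ w₂ f = begin
  ∑ l₁ (λ a → w₁ a * ∑ l₂ (λ b → w₂ b * f a b))
    ≡⟨ ∑-cong l₁ (λ a → *-distribˡ-∑ (w₁ a) l₂ _) ⟩
  ∑ l₁ (λ a → ∑ l₂ (λ b → w₁ a * (w₂ b * f a b)))
    ≡⟨ ∑-cong l₁ (λ a → ∑-cong l₂ (λ b → exchange (w₁ a) (w₂ b) (f a b))) ⟩
  ∑ l₁ (λ a → ∑ l₂ (λ b → w₂ b * (w₁ a * f a b)))
    ≡⟨ ∑-comm l₁ l₂ _ ⟩
  ∑ l₂ (λ b → ∑ l₁ (λ a → w₂ b * (w₁ a * f a b)))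
    ≡⟨ ∑-cong l₂ (λ b → *-distribˡ-∑ (w₂ b) l₁ _) ⟨
  ∑ l₂ (λ b → w₂ b * ∑ l₁ (λ a → w₁ a * f a b)) ∎
  where
  open ≡-Reasoning
  exchange : ∀ x y z → x * (y * z) ≡ y * (x * z)
  exchange = solve 3 (λ x y z → x :* (y :* z) := y :* (x :* z)) refl

-- Uniform random strings and splicing

bits : List Bool
bits = false ∷ true ∷ []

∑-bits : (g : Bool → ℚ) → ∑ bits g ≡ g false + g true
∑-bits g = cong (g false +_) (QP.+-identityʳ (g true))

∑-allStrings-suc : ∀ n (f : List Bool → ℚ) →
  ∑ (allStrings (suc n)) f ≡ ∑ bits (λ b → ∑ (allStrings n) (λ x → f (b ∷ x)))
∑-allStrings-suc n f = trans (∑-concatMap _ (allStrings n) f) (∑-comm (allStrings n) bits (λ x b → f (b ∷ x)))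

∈-allStrings⁺ : ∀ {n} (v : Vec Bool n) → Vec.toList v ∈ allStrings n
∈-allStrings⁺ Vec.[]      = here refl
∈-allStrings⁺ (b Vec.∷ v) =
  ∈-concatMap⁺ (λ x → (false ∷ x) ∷ (true ∷ x) ∷ []) (Any.map (λ { refl → cons∈ b }) (∈-allStrings⁺ v))
  where
  cons∈ : ∀ {x : List Bool} (b : Bool) → (b ∷ x) ∈ (false ∷ x) ∷ (true ∷ x) ∷ []
  cons∈ false = here refl
  cons∈ true  = there (here refl)

∈-allStrings⁻ : ∀ {n x} → x ∈ allStrings n → ∃[ v ] Vec.toList {n = n} v ≡ x
∈-allStrings⁻ {zero}  (here refl) = Vec.[] , refl
∈-allStrings⁻ {suc n} x∈ with find (∈-concatMap⁻ _ {xs = allStrings n} x∈)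
... | y , y∈ , here refl         = let v , v≡y = ∈-allStrings⁻ y∈ in false Vec.∷ v , cong (false ∷_) v≡y
... | y , y∈ , there (here refl) = let v , v≡y = ∈-allStrings⁻ y∈ in true Vec.∷ v , cong (true ∷_) v≡y

∈-allStrings⇒length : ∀ {n x} → x ∈ allStrings n → length x ≡ n
∈-allStrings⇒length x∈ = let v , v≡x = ∈-allStrings⁻ x∈ in trans (cong length (sym v≡x)) (VecP.length-toList v)

uniform : ℕ → List Bool → ℚ
uniform n _ = ½ ^ℚ n

𝔼ᵤ : ℕ → (List Bool → ℚ) → ℚ
𝔼ᵤ n = 𝔼 (allStrings n) (uniform n)

avgOver≡𝔼ᵤ : ∀ n f → avgOver n f ≡ 𝔼ᵤ n f
avgOver≡𝔼ᵤ n f = *-distribˡ-∑ (½ ^ℚ n) (allStrings n) f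

uniform-nonNeg : ∀ n x → 0ℚ ≤ uniform n x
uniform-nonNeg zero    x = QP.nonNegative⁻¹ 1ℚ
uniform-nonNeg (suc n) x = *-nonNeg (QP.nonNegative⁻¹ ½) (uniform-nonNeg n x)

∑-uniform : ∀ n → ∑ (allStrings n) (uniform n) ≡ 1ℚ
∑-uniform zero    = refl
∑-uniform (suc n) = begin
  ∑ (allStrings (suc n)) (uniform (suc n))
    ≡⟨ ∑-allStrings-suc n (uniform (suc n)) ⟩
  ∑ bits (λ _ → ∑ (allStrings n) (λ _ → ½ * ½ ^ℚ n))
    ≡⟨ ∑-cong bits (λ _ → *-distribˡ-∑ ½ (allStrings n) (uniform n)) ⟨
  ∑ bits (λ _ → ½ * ∑ (allStrings n) (uniform n))
    ≡⟨ ∑-cong bits (λ _ → cong (½ *_) (∑-uniform n)) ⟩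
  ∑ bits (λ _ → ½ * 1ℚ)
    ≡⟨⟩
  1ℚ ∎
  where open ≡-Reasoning

splice : List Bool → List Bool → List Bool → List Bool
splice (b ∷ s) (a ∷ x) (c ∷ w) = (if b then c else a) ∷ splice s x w
splice _       x       _       = x

weight : List Bool → ℕ
weight []          = 0
weight (true  ∷ s) = suc (weight s)
weight (false ∷ s) = weight s

∑² : {A : Set} → List A → (A → A → ℚ) → ℚ
∑² l F = ∑ l (λ x → ∑ l (F x))

∑²-allStrings-suc : ∀ n (F : List Bool → List Bool → ℚ) →
  ∑² (allStrings (suc n)) F ≡ ∑ bits (λ a → ∑ bits (λ b → ∑² (allStrings n) (λ x w → F (a ∷ x) (b ∷ w))))
∑²-allStrings-suc n F = begin
  ∑² (allStrings (suc n)) F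
    ≡⟨ ∑-allStrings-suc n _ ⟩
  ∑ bits (λ a → ∑ (allStrings n) (λ x → ∑ (allStrings (suc n)) (F (a ∷ x))))
    ≡⟨ ∑-cong bits (λ a → ∑-cong (allStrings n) (λ x → ∑-allStrings-suc n (F (a ∷ x)))) ⟩
  ∑ bits (λ a → ∑ (allStrings n) (λ x → ∑ bits (λ b → ∑ (allStrings n) (λ w → F (a ∷ x) (b ∷ w)))))
    ≡⟨ ∑-cong bits (λ a → ∑-comm (allStrings n) bits (λ x b → ∑ (allStrings n) (λ w → F (a ∷ x) (b ∷ w)))) ⟩
  ∑ bits (λ a → ∑ bits (λ b → ∑² (allStrings n) (λ x w → F (a ∷ x) (b ∷ w)))) ∎
  where open ≡-Reasoning

-- (x , w) ↦ (splice s x w , splice s w x) exchanges the s-bits of x and w: a bijection of pairs.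
∑²-splice : ∀ n s (F : List Bool → List Bool → ℚ) →
  ∑² (allStrings n) (λ x w → F (splice s x w) (splice s w x)) ≡ ∑² (allStrings n) F
∑²-splice zero    []          F = refl
∑²-splice zero    (_ ∷ _)     F = refl
∑²-splice (suc n) []          F = refl
∑²-splice (suc n) (false ∷ s) F = begin
  _ ≡⟨ ∑²-allStrings-suc n _ ⟩
  ∑ bits (λ a → ∑ bits (λ b → ∑² (allStrings n) (λ x w → F (a ∷ splice s x w) (b ∷ splice s w x))))
    ≡⟨ ∑-cong bits (λ a → ∑-cong bits (λ b → ∑²-splice n s (λ x w → F (a ∷ x) (b ∷ w)))) ⟩
  ∑ bits (λ a → ∑ bits (λ b → ∑² (allStrings n) (λ x w → F (a ∷ x) (b ∷ w))))
    ≡⟨ ∑²-allStrings-suc n F ⟨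
  _ ∎
  where open ≡-Reasoning
∑²-splice (suc n) (true ∷ s)  F = begin
  _ ≡⟨ ∑²-allStrings-suc n _ ⟩
  ∑ bits (λ a → ∑ bits (λ b → ∑² (allStrings n) (λ x w → F (b ∷ splice s x w) (a ∷ splice s w x))))
    ≡⟨ ∑-cong bits (λ a → ∑-cong bits (λ b → ∑²-splice n s (λ x w → F (b ∷ x) (a ∷ w)))) ⟩
  ∑ bits (λ a → ∑ bits (λ b → ∑² (allStrings n) (λ x w → F (b ∷ x) (a ∷ w))))
    ≡⟨ ∑-comm bits bits (λ a b → ∑² (allStrings n) (λ x w → F (b ∷ x) (a ∷ w))) ⟩
  ∑ bits (λ b → ∑ bits (λ a → ∑² (allStrings n) (λ x w → F (b ∷ x) (a ∷ w))))
    ≡⟨ ∑²-allStrings-suc n F ⟨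
  _ ∎
  where open ≡-Reasoning

𝔼ᵤ²≡∑² : ∀ n (F : List Bool → List Bool → ℚ) →
  𝔼ᵤ n (λ x → 𝔼ᵤ n (F x)) ≡ ∑² (allStrings n) (λ x w → ½ ^ℚ n * (½ ^ℚ n * F x w))
𝔼ᵤ²≡∑² n F = ∑-cong (allStrings n) (λ x → *-distribˡ-∑ (½ ^ℚ n) (allStrings n) _)

𝔼ᵤ²-splice : ∀ n s (F : List Bool → List Bool → ℚ) →
  𝔼ᵤ n (λ x → 𝔼ᵤ n (λ w → F (splice s x w) (splice s w x))) ≡ 𝔼ᵤ n (λ x → 𝔼ᵤ n (F x))
𝔼ᵤ²-splice n s F = trans (𝔼ᵤ²≡∑² n _)
  (trans (∑²-splice n s (λ x w → ½ ^ℚ n * (½ ^ℚ n * F x w))) (sym (𝔼ᵤ²≡∑² n F)))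

-- Longest common subsequences

maxℚ-ub : ∀ {q qs} → q ∈ qs → q ≤ maxℚ qs
maxℚ-ub {q} {r ∷ rs} q∈ =
  ListP.foldr-preservesᵒ ⊔-preserves-≥ r rs (Sum.map QP.≤-reflexive (Any.map QP.≤-reflexive) (Any.toSum q∈))
  where
  ⊔-preserves-≥ : ∀ x y → q ≤ x ⊎ q ≤ y → q ≤ x ⊔ y
  ⊔-preserves-≥ x y = [ (λ q≤x → QP.≤-trans q≤x (QP.p≤p⊔q x y))
                      , (λ q≤y → QP.≤-trans q≤y (QP.p≤q⊔p x y)) ]

maxℚ-∈ : ∀ {q qs} → q ∈ qs → maxℚ qs ∈ qs
maxℚ-∈ {qs = r ∷ rs} _ = [ here , there ]′ (foldr-selective {_•_ = _⊔_} QP.⊔-sel r rs)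

maxℕ-ub : ∀ {m ms} → m ∈ ms → m ℕ.≤ maxℕ ms
maxℕ-ub {m} {ms} m∈ = ListP.foldr-preservesᵒ ⊔-preserves-≥ 0 ms (inj₂ (Any.map ℕP.≤-reflexive m∈))
  where
  ⊔-preserves-≥ : ∀ x y → m ℕ.≤ x ⊎ m ℕ.≤ y → m ℕ.≤ x ℕ.⊔ y
  ⊔-preserves-≥ x y = [ (λ m≤x → ℕP.≤-trans m≤x (ℕP.m≤m⊔n x y))
                      , (λ m≤y → ℕP.≤-trans m≤y (ℕP.m≤n⊔m x y)) ]

maxℕ-lub : ∀ {ms B} → (∀ {m} → m ∈ ms → m ℕ.≤ B) → maxℕ ms ℕ.≤ B
maxℕ-lub {ms} ub = ListP.foldr-preservesᵇ ℕP.⊔-lub ℕ.z≤n (All.tabulate ub)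

subsequences-⊆ : (u : List Bool) → All (_⊆ u) (subsequences u)
subsequences-⊆ []      = [] ∷ []
subsequences-⊆ (b ∷ u) =
  AllP.++⁺ (AllP.map⁺ (All.map (refl ∷_) (subsequences-⊆ u))) (All.map (b ∷ʳ_) (subsequences-⊆ u))

∈-subsequences : ∀ {s u : List Bool} → s ⊆ u → s ∈ subsequences u
∈-subsequences []                = here refl
∈-subsequences {u = b ∷ u} (_ ∷ʳ p)  = ∈-++⁺ʳ (map (b ∷_) (subsequences u)) (∈-subsequences p)
∈-subsequences (refl ∷ p) = ∈-++⁺ˡ (∈-map⁺ _ (∈-subsequences p))

length≤lcsLen : ∀ {s u v} → s ⊆ u → s ⊆ v → length s ℕ.≤ lcsLen u v
length≤lcsLen {v = v} s⊆u s⊆v = maxℕ-ub (∈-map⁺ length (∈-filter⁺ (_⊆? v) (∈-subsequences s⊆u) s⊆v))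

lcsLen-lub : ∀ {u v B} → (∀ {s} → s ⊆ u → s ⊆ v → length s ℕ.≤ B) → lcsLen u v ℕ.≤ B
lcsLen-lub {u} {v} {B} common≤B = maxℕ-lub bound
  where
  bound : ∀ {m} → m ∈ map length (filter (_⊆? v) (subsequences u)) → m ℕ.≤ B
  bound m∈ with ∈-map⁻ length m∈
  ... | s , s∈ , refl with ∈-filter⁻ (_⊆? v) s∈
  ... | s∈subs , s⊆v = common≤B (All.lookup (subsequences-⊆ u) s∈subs) s⊆v

lcsLen-comm : ∀ u v → lcsLen u v ≡ lcsLen v u
lcsLen-comm u v = ℕP.≤-antisym (lcsLen≤ u v) (lcsLen≤ v u)
  where
  lcsLen≤ : ∀ u v → lcsLen u v ℕ.≤ lcsLen v u
  lcsLen≤ u v = lcsLen-lub {u} {v} (λ s⊆u s⊆v → length≤lcsLen s⊆v s⊆u)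

weight-∷ : ∀ b s → weight s ℕ.≤ weight (b ∷ s)
weight-∷ true  s = ℕP.n≤1+n (weight s)
weight-∷ false s = ℕP.≤-refl

-- s₁ drops from s₀ the letters matched at positions set in s.
⊆-splice : ∀ {s₀ x : List Bool} → s₀ ⊆ x → ∀ s w →
  ∃[ s₁ ] s₁ ⊆ s₀ × s₁ ⊆ splice s x w × length s₀ ℕ.≤ length s₁ ℕ.+ weight s
⊆-splice {s₀} p       []      w       = s₀ , ⊆-refl , p , ℕP.m≤m+n _ _
⊆-splice      []      (_ ∷ _) w       = [] , [] , [] , ℕ.z≤n
⊆-splice {s₀} p@(_ ∷ʳ _) (_ ∷ _) [] = s₀ , ⊆-refl , p , ℕP.m≤m+n _ _
⊆-splice {s₀} p@(_ ∷ _)  (_ ∷ _) [] = s₀ , ⊆-refl , p , ℕP.m≤m+n _ _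
⊆-splice (_ ∷ʳ p) (b ∷ s) (_ ∷ w) with ⊆-splice p s w
... | s₁ , s₁⊆s₀ , s₁⊆x′ , ≤s₁ =
  s₁ , s₁⊆s₀ , _ ∷ʳ s₁⊆x′ , ℕP.≤-trans ≤s₁ (ℕP.+-monoʳ-≤ (length s₁) (weight-∷ b s))
⊆-splice (_∷_ {x = a} refl p) (false ∷ s) (_ ∷ w) with ⊆-splice p s w
... | s₁ , s₁⊆s₀ , s₁⊆x′ , ≤s₁ =
  a ∷ s₁ , refl ∷ s₁⊆s₀ , refl ∷ s₁⊆x′ , ℕ.s≤s ≤s₁
⊆-splice (_∷_ {x = a} refl p) (true  ∷ s) (_ ∷ w) with ⊆-splice p s w
... | s₁ , s₁⊆s₀ , s₁⊆x′ , ≤s₁ =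
  s₁ , a ∷ʳ s₁⊆s₀ , _ ∷ʳ s₁⊆x′ , ℕP.≤-trans (ℕ.s≤s ≤s₁) (ℕP.≤-reflexive (sym (ℕP.+-suc (length s₁) (weight s))))

lcsLen-splice : ∀ z x s w → lcsLen z x ℕ.≤ lcsLen z (splice s x w) ℕ.+ weight s
lcsLen-splice z x s w = lcsLen-lub common≤
  where
  common≤ : ∀ {s₀} → s₀ ⊆ z → s₀ ⊆ x → length s₀ ℕ.≤ lcsLen z (splice s x w) ℕ.+ weight s
  common≤ s₀⊆z s₀⊆x with ⊆-splice s₀⊆x s w
  ... | s₁ , s₁⊆s₀ , s₁⊆x′ , ≤s₁ =
    ℕP.≤-trans ≤s₁ (ℕP.+-monoˡ-≤ (weight s) (length≤lcsLen (⊆-trans s₁⊆s₀ s₀⊆z) s₁⊆x′))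

-- Deletion masks

infix 4 _⊑_
infixr 6 _∪_

_⊑_ : List Bool → List Bool → Set
[]          ⊑ _           = ⊤
(_ ∷ _)     ⊑ []          = ⊥
(false ∷ m) ⊑ (_ ∷ s)     = m ⊑ s
(true ∷ m)  ⊑ (true ∷ s)  = m ⊑ s
(true ∷ m)  ⊑ (false ∷ s) = ⊥

_∪_ : List Bool → List Bool → List Bool
[]      ∪ s       = s
m       ∪ []      = m
(a ∷ m) ∪ (b ∷ s) = (a ∨ b) ∷ (m ∪ s)

⊑-refl : ∀ m → m ⊑ m
⊑-refl []          = tt
⊑-refl (false ∷ m) = ⊑-refl m
⊑-refl (true ∷ m)  = ⊑-refl m

⊑-∪ˡ : ∀ m s → m ⊑ m ∪ s
⊑-∪ˡ []          s       = tt
⊑-∪ˡ m@(_ ∷ _)   []      = ⊑-refl m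
⊑-∪ˡ (false ∷ m) (_ ∷ s) = ⊑-∪ˡ m s
⊑-∪ˡ (true ∷ m)  (_ ∷ s) = ⊑-∪ˡ m s

⊑-∪ʳ : ∀ m s′ s → m ⊑ s → m ⊑ s′ ∪ s
⊑-∪ʳ []          s′               s          _   = tt
⊑-∪ʳ (_ ∷ _)     []               s          m⊑s = m⊑s
⊑-∪ʳ (false ∷ m) (_ ∷ s′)         (_ ∷ s)    m⊑s = ⊑-∪ʳ m s′ s m⊑s
⊑-∪ʳ (true ∷ m)  (false ∷ s′)     (true ∷ s) m⊑s = ⊑-∪ʳ m s′ s m⊑s
⊑-∪ʳ (true ∷ m)  (true ∷ s′)      (true ∷ s) m⊑s = ⊑-∪ʳ m s′ s m⊑s

weight-∪ : ∀ m s → weight (m ∪ s) ℕ.≤ weight m ℕ.+ weight s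
weight-∪ []          s           = ℕP.≤-refl
weight-∪ m@(_ ∷ _)   []          = ℕP.m≤m+n (weight m) 0
weight-∪ (false ∷ m) (false ∷ s) = weight-∪ m s
weight-∪ (false ∷ m) (true ∷ s)  =
  ℕP.≤-trans (ℕ.s≤s (weight-∪ m s)) (ℕP.≤-reflexive (sym (ℕP.+-suc (weight m) (weight s))))
weight-∪ (true ∷ m)  (false ∷ s) = ℕ.s≤s (weight-∪ m s)
weight-∪ (true ∷ m)  (true ∷ s)  =
  ℕ.s≤s (ℕP.≤-trans (weight-∪ m s) (ℕP.+-monoʳ-≤ (weight m) (ℕP.n≤1+n (weight s))))

⋃ : ∀ {t} → Vec (List Bool) t → List Bool
⋃ = Vec.foldr′ _∪_ []

⊑-⋃ : ∀ {t} (ms : Vec (List Bool) t) → VecAll.All (_⊑ ⋃ ms) ms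
⊑-⋃ Vec.[]         = VecAll.[]
⊑-⋃ (m Vec.∷ ms) = ⊑-∪ˡ m (⋃ ms) VecAll.∷ VecAll.map (λ {m′} → ⊑-∪ʳ m′ m (⋃ ms)) (⊑-⋃ ms)

weight-⋃ : ∀ {t} (ms : Vec (List Bool) t) → weight (⋃ ms) ℕ.≤ Vec.sum (Vec.map weight ms)
weight-⋃ Vec.[]         = ℕ.z≤n
weight-⋃ (m Vec.∷ ms) = ℕP.≤-trans (weight-∪ m (⋃ ms)) (ℕP.+-monoʳ-≤ (weight m) (weight-⋃ ms))

applyMask-[]ʳ : ∀ x → applyMask x [] ≡ []
applyMask-[]ʳ []      = refl
applyMask-[]ʳ (_ ∷ _) = refl

applyMask-splice : ∀ m s (w x : List Bool) → m ⊑ s → length w ≡ length x →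
  applyMask (splice s w x) m ≡ applyMask x m
applyMask-splice []          s       w       x       _   _   = trans (applyMask-[]ʳ (splice s w x)) (sym (applyMask-[]ʳ x))
applyMask-splice (_ ∷ _)     (_ ∷ _) []      []      _   _   = refl
applyMask-splice (false ∷ m) (_ ∷ s) (_ ∷ w) (_ ∷ x) m⊑s |w| = applyMask-splice m s w x m⊑s (ℕP.suc-injective |w|)
applyMask-splice (true ∷ m)  (true ∷ s) (_ ∷ w) (a ∷ x) m⊑s |w| =
  cong (a ∷_) (applyMask-splice m s w x m⊑s (ℕP.suc-injective |w|))

module _ (δ : ℚ) where

  private
    ρ : ℚ
    ρ = 1ℚ - δ

  𝔼-maskProb-suc : ∀ n (f : List Bool → ℚ) →
    𝔼 (allStrings (suc n)) (maskProb δ) f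
      ≡ δ * 𝔼 (allStrings n) (maskProb δ) (λ m → f (false ∷ m))
        + ρ * 𝔼 (allStrings n) (maskProb δ) (λ m → f (true ∷ m))
  𝔼-maskProb-suc n f = begin
    𝔼 (allStrings (suc n)) (maskProb δ) f
      ≡⟨ ∑-allStrings-suc n _ ⟩
    ∑ bits (λ b → 𝔼 L (λ m → maskProb δ (b ∷ m)) (λ m → f (b ∷ m)))
      ≡⟨ ∑-bits (λ b → 𝔼 L (λ m → maskProb δ (b ∷ m)) (λ m → f (b ∷ m))) ⟩
    𝔼 L (λ m → δ * maskProb δ m) (λ m → f (false ∷ m)) + 𝔼 L (λ m → ρ * maskProb δ m) (λ m → f (true ∷ m))
      ≡⟨ cong₂ _+_ (scale δ (λ m → f (false ∷ m))) (scale ρ (λ m → f (true ∷ m))) ⟩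
    δ * 𝔼 L (maskProb δ) (λ m → f (false ∷ m)) + ρ * 𝔼 L (maskProb δ) (λ m → f (true ∷ m)) ∎
    where
    open ≡-Reasoning
    L : List (List Bool)
    L = allStrings n
    scale : (c : ℚ) (g : List Bool → ℚ) → 𝔼 L (λ m → c * maskProb δ m) g ≡ c * 𝔼 L (maskProb δ) g
    scale c g = trans (∑-cong L (λ m → QP.*-assoc c (maskProb δ m) (g m))) (sym (*-distribˡ-∑ c L _))

  ∑-maskProb : ∀ n → ∑ (allStrings n) (maskProb δ) ≡ 1ℚ
  ∑-maskProb zero    = refl
  ∑-maskProb (suc n) = begin
    ∑ (allStrings (suc n)) (maskProb δ)                       ≡⟨ 𝔼-one (allStrings (suc n)) (maskProb δ) ⟨
    𝔼 (allStrings (suc n)) (maskProb δ) (λ _ → 1ℚ)            ≡⟨ 𝔼-maskProb-suc n (λ _ → 1ℚ) ⟩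
    δ * 𝔼 L (maskProb δ) (λ _ → 1ℚ) + ρ * 𝔼 L (maskProb δ) (λ _ → 1ℚ)
      ≡⟨ cong (λ e → δ * e + ρ * e) (trans (𝔼-one L (maskProb δ)) (∑-maskProb n)) ⟩
    δ * 1ℚ + ρ * 1ℚ
      ≡⟨ solve 1 (λ d → d :* con 1ℚ :+ (con 1ℚ :- d) :* con 1ℚ := con 1ℚ) refl δ ⟩
    1ℚ                                                        ∎
    where
    open ≡-Reasoning
    L : List (List Bool)
    L = allStrings n

  𝔼-weight : ∀ n → 𝔼 (allStrings n) (maskProb δ) (λ m → fromℕ (weight m)) ≡ ρ * fromℕ n
  𝔼-weight zero    = solve 1 (λ d → con 1ℚ :* con 0ℚ :+ con 0ℚ := (con 1ℚ :- d) :* con 0ℚ) refl δ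
  𝔼-weight (suc n) = begin
    𝔼 (allStrings (suc n)) (maskProb δ) (λ m → fromℕ (weight m))
      ≡⟨ 𝔼-maskProb-suc n (λ m → fromℕ (weight m)) ⟩
    δ * 𝔼 L (maskProb δ) (λ m → fromℕ (weight m)) + ρ * 𝔼 L (maskProb δ) (λ m → fromℕ (1 ℕ.+ weight m))
      ≡⟨ cong (λ e → δ * 𝔼 L (maskProb δ) (λ m → fromℕ (weight m)) + ρ * e) shifted ⟩
    δ * 𝔼 L (maskProb δ) (λ m → fromℕ (weight m)) + ρ * (1ℚ + 𝔼 L (maskProb δ) (λ m → fromℕ (weight m)))
      ≡⟨ cong (λ e → δ * e + ρ * (1ℚ + e)) (𝔼-weight n) ⟩
    δ * (ρ * fromℕ n) + ρ * (1ℚ + ρ * fromℕ n)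
      ≡⟨ solve 2 (λ d k → d :* ((con 1ℚ :- d) :* k) :+ (con 1ℚ :- d) :* (con 1ℚ :+ (con 1ℚ :- d) :* k)
                          := (con 1ℚ :- d) :* (con 1ℚ :+ k)) refl δ (fromℕ n) ⟩
    ρ * (1ℚ + fromℕ n)
      ≡⟨ cong (ρ *_) (fromℕ-+ 1 n) ⟨
    ρ * fromℕ (suc n) ∎
    where
    open ≡-Reasoning
    L : List (List Bool)
    L = allStrings n
    shifted : 𝔼 L (maskProb δ) (λ m → fromℕ (1 ℕ.+ weight m)) ≡ 1ℚ + 𝔼 L (maskProb δ) (λ m → fromℕ (weight m))
    shifted = trans (𝔼-cong L (maskProb δ) (λ m → fromℕ-+ 1 (weight m)))
      (trans (𝔼-distrib-+ L (maskProb δ) (λ _ → 1ℚ) (λ m → fromℕ (weight m)))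
        (cong (_+ 𝔼 L (maskProb δ) (λ m → fromℕ (weight m))) (𝔼-const L (maskProb δ) (∑-maskProb n) 1ℚ)))

  𝔼-allMaskTuples-suc : ∀ t n (F : Vec (List Bool) (suc t) → ℚ) →
    𝔼 (allMaskTuples (suc t) n) (tupleProb δ) F
      ≡ 𝔼 (allStrings n) (maskProb δ) (λ m → 𝔼 (allMaskTuples t n) (tupleProb δ) (λ ms → F (m Vec.∷ ms)))
  𝔼-allMaskTuples-suc t n F = begin
    𝔼 (allMaskTuples (suc t) n) (tupleProb δ) F
      ≡⟨ ∑-concatMap _ (allStrings n) _ ⟩
    ∑ (allStrings n) (λ m → ∑ (map (m Vec.∷_) M) (λ ms → tupleProb δ ms * F ms))
      ≡⟨ ∑-cong (allStrings n) (λ m → ∑-map (m Vec.∷_) M _) ⟩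
    ∑ (allStrings n) (λ m → ∑ M (λ ms → maskProb δ m * tupleProb δ ms * F (m Vec.∷ ms)))
      ≡⟨ ∑-cong (allStrings n) (λ m → ∑-cong M (λ ms → QP.*-assoc (maskProb δ m) _ _)) ⟩
    ∑ (allStrings n) (λ m → ∑ M (λ ms → maskProb δ m * (tupleProb δ ms * F (m Vec.∷ ms))))
      ≡⟨ ∑-cong (allStrings n) (λ m → *-distribˡ-∑ (maskProb δ m) M _) ⟨
    𝔼 (allStrings n) (maskProb δ) (λ m → 𝔼 M (tupleProb δ) (λ ms → F (m Vec.∷ ms))) ∎
    where
    open ≡-Reasoning
    M : List (Vec (List Bool) t)
    M = allMaskTuples t n

  ∑-tupleProb : ∀ t n → ∑ (allMaskTuples t n) (tupleProb δ) ≡ 1ℚ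
  ∑-tupleProb zero    n = refl
  ∑-tupleProb (suc t) n = begin
    ∑ (allMaskTuples (suc t) n) (tupleProb δ)                 ≡⟨ 𝔼-one (allMaskTuples (suc t) n) (tupleProb δ) ⟨
    𝔼 (allMaskTuples (suc t) n) (tupleProb δ) (λ _ → 1ℚ)      ≡⟨ 𝔼-allMaskTuples-suc t n (λ _ → 1ℚ) ⟩
    𝔼 L (maskProb δ) (λ _ → 𝔼 M (tupleProb δ) (λ _ → 1ℚ))
      ≡⟨ cong (λ e → 𝔼 L (maskProb δ) (λ _ → e)) (trans (𝔼-one M (tupleProb δ)) (∑-tupleProb t n)) ⟩
    𝔼 L (maskProb δ) (λ _ → 1ℚ)                               ≡⟨ 𝔼-const L (maskProb δ) (∑-maskProb n) 1ℚ ⟩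
    1ℚ                                                        ∎
    where
    open ≡-Reasoning
    L : List (List Bool)
    L = allStrings n
    M : List (Vec (List Bool) t)
    M = allMaskTuples t n

  𝔼-totalWeight : ∀ t n →
    𝔼 (allMaskTuples t n) (tupleProb δ) (λ ms → fromℕ (Vec.sum (Vec.map weight ms))) ≡ fromℕ t * ρ * fromℕ n
  𝔼-totalWeight zero    n = solve 2 (λ r k → con 1ℚ :* con 0ℚ :+ con 0ℚ := con 0ℚ :* r :* k) refl ρ (fromℕ n)
  𝔼-totalWeight (suc t) n = begin
    𝔼 (allMaskTuples (suc t) n) (tupleProb δ) (λ ms → fromℕ (Vec.sum (Vec.map weight ms)))
      ≡⟨ 𝔼-allMaskTuples-suc t n _ ⟩
    𝔼 L (maskProb δ) (λ m → 𝔼 M (tupleProb δ) (λ ms → fromℕ (weight m ℕ.+ Vec.sum (Vec.map weight ms))))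
      ≡⟨ 𝔼-cong L (maskProb δ) addHead ⟩
    𝔼 L (maskProb δ) (λ m → fromℕ (weight m) + fromℕ t * ρ * fromℕ n)
      ≡⟨ 𝔼-distrib-+ L (maskProb δ) (λ m → fromℕ (weight m)) (λ _ → fromℕ t * ρ * fromℕ n) ⟩
    𝔼 L (maskProb δ) (λ m → fromℕ (weight m)) + 𝔼 L (maskProb δ) (λ _ → fromℕ t * ρ * fromℕ n)
      ≡⟨ cong₂ _+_ (𝔼-weight n) (𝔼-const L (maskProb δ) (∑-maskProb n) _) ⟩
    ρ * fromℕ n + fromℕ t * ρ * fromℕ n
      ≡⟨ solve 3 (λ r k c → r :* k :+ c :* r :* k := (con 1ℚ :+ c) :* r :* k) refl ρ (fromℕ n) (fromℕ t) ⟩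
    (1ℚ + fromℕ t) * ρ * fromℕ n
      ≡⟨ cong (λ c → c * ρ * fromℕ n) (fromℕ-+ 1 t) ⟨
    fromℕ (suc t) * ρ * fromℕ n ∎
    where
    open ≡-Reasoning
    L : List (List Bool)
    L = allStrings n
    M : List (Vec (List Bool) t)
    M = allMaskTuples t n
    addHead : ∀ m → 𝔼 M (tupleProb δ) (λ ms → fromℕ (weight m ℕ.+ Vec.sum (Vec.map weight ms)))
                      ≡ fromℕ (weight m) + fromℕ t * ρ * fromℕ n
    addHead m = begin
      _ ≡⟨ 𝔼-cong M (tupleProb δ) (λ ms → fromℕ-+ (weight m) _) ⟩
      _ ≡⟨ 𝔼-distrib-+ M (tupleProb δ) (λ _ → fromℕ (weight m)) (λ ms → fromℕ (Vec.sum (Vec.map weight ms))) ⟩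
      _ ≡⟨ cong₂ _+_ (𝔼-const M (tupleProb δ) (∑-tupleProb t n) _) (𝔼-totalWeight t n) ⟩
      _ ∎

  module _ (δ≥0 : 0ℚ ≤ δ) (ρ≥0 : 0ℚ ≤ ρ) where

    maskProb-nonNeg : ∀ m → 0ℚ ≤ maskProb δ m
    maskProb-nonNeg []          = QP.nonNegative⁻¹ 1ℚ
    maskProb-nonNeg (true ∷ m)  = *-nonNeg ρ≥0 (maskProb-nonNeg m)
    maskProb-nonNeg (false ∷ m) = *-nonNeg δ≥0 (maskProb-nonNeg m)

    tupleProb-nonNeg : ∀ {t} (ms : Vec (List Bool) t) → 0ℚ ≤ tupleProb δ ms
    tupleProb-nonNeg Vec.[]         = QP.nonNegative⁻¹ 1ℚ
    tupleProb-nonNeg (m Vec.∷ ms) = *-nonNeg (maskProb-nonNeg m) (tupleProb-nonNeg ms)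

-- z x reads x only at the positions set in s.
DependsOnlyOn : {B : Set} → List Bool → (List Bool → B) → Set
DependsOnlyOn s z = ∀ x w → length w ≡ length x → z (splice s w x) ≡ z x

𝔼ᵤ-lcsLen-dependsOnlyOn : ∀ n s (z : List Bool → List Bool) L → DependsOnlyOn s z →
  (∀ w → 𝔼ᵤ n (λ x → fromℕ (lcsLen (z w) x)) ≤ L) →
  𝔼ᵤ n (λ x → fromℕ (lcsLen (z x) x)) ≤ L + fromℕ (weight s)
𝔼ᵤ-lcsLen-dependsOnlyOn n s z L z-dep guess≤L = begin
  𝔼ᵤ n (λ x → lcs (z x) x)
    ≡⟨ 𝔼-cong U u (λ x → 𝔼-const U u (∑-uniform n) _) ⟨
  𝔼ᵤ n (λ x → 𝔼ᵤ n (λ _ → lcs (z x) x))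
    ≤⟨ 𝔼-mono U u (uniform-nonNeg n) (λ x x∈ → 𝔼-mono U u (uniform-nonNeg n) (λ w w∈ → resample x w x∈ w∈)) ⟩
  𝔼ᵤ n (λ x → 𝔼ᵤ n (λ w → lcs (z (splice s w x)) (splice s x w) + c))
    ≡⟨ trans (𝔼-cong U u (λ x → 𝔼-+-const U u (∑-uniform n) _ c)) (𝔼-+-const U u (∑-uniform n) _ c) ⟩
  𝔼ᵤ n (λ x → 𝔼ᵤ n (λ w → lcs (z (splice s w x)) (splice s x w))) + c
    ≡⟨ cong (_+ c) (𝔼ᵤ²-splice n s (λ x w → lcs (z w) x)) ⟩
  𝔼ᵤ n (λ x → 𝔼ᵤ n (λ w → lcs (z w) x)) + c
    ≡⟨ cong (_+ c) (𝔼-comm U u U u (λ x w → lcs (z w) x)) ⟩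
  𝔼ᵤ n (λ w → 𝔼ᵤ n (λ x → lcs (z w) x)) + c
    ≤⟨ QP.+-monoˡ-≤ c (𝔼-mono U u (uniform-nonNeg n) (λ w _ → guess≤L w)) ⟩
  𝔼ᵤ n (λ _ → L) + c
    ≡⟨ cong (_+ c) (𝔼-const U u (∑-uniform n) L) ⟩
  L + c ∎
  where
  open QP.≤-Reasoning
  U : List (List Bool)
  U = allStrings n
  u : List Bool → ℚ
  u = uniform n
  c : ℚ
  c = fromℕ (weight s)
  lcs : List Bool → List Bool → ℚ
  lcs y x = fromℕ (lcsLen y x)
  resample : ∀ x w → x ∈ U → w ∈ U → lcs (z x) x ≤ lcs (z (splice s w x)) (splice s x w) + c
  resample x w x∈ w∈ rewrite z-dep x w (trans (∈-allStrings⇒length {n} w∈) (sym (∈-allStrings⇒length {n} x∈))) =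
    QP.≤-trans (fromℕ-mono (lcsLen-splice (z x) x s w))
               (QP.≤-reflexive (fromℕ-+ (lcsLen (z x) (splice s x w)) (weight s)))

𝔼ᵤ-lcsLen≤L0avg : ∀ n (v : Vec Bool n) → 𝔼ᵤ n (λ x → fromℕ (lcsLen (Vec.toList v) x)) ≤ L0avg n
𝔼ᵤ-lcsLen≤L0avg n v = begin
  𝔼ᵤ n (λ x → fromℕ (lcsLen (Vec.toList v) x))
    ≡⟨ 𝔼-cong (allStrings n) (uniform n) (λ x → cong fromℕ (lcsLen-comm _ x)) ⟩
  𝔼ᵤ n (λ x → fromℕ (lcsLen x (Vec.toList v)))
    ≡⟨ avgOver≡𝔼ᵤ n _ ⟨
  avgOver n (λ x → fromℕ (lcsLen x (Vec.toList v)))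
    ≤⟨ maxℚ-ub (∈-map⁺ _ (∈-allStrings⁺ v)) ⟩
  L0avg n ∎
  where open QP.≤-Reasoning

L0avg-attained : ∀ n → ∃[ v ] L0avg n ≡ 𝔼ᵤ n (λ x → fromℕ (lcsLen (Vec.toList {n = n} v) x))
L0avg-attained n =
  let z , z∈ , L0≡ = ∈-map⁻ value (maxℚ-∈ (∈-map⁺ value (∈-allStrings⁺ (Vec.replicate n false))))
      v , v≡z      = ∈-allStrings⁻ z∈
  in v , (begin
    L0avg n
      ≡⟨ L0≡ ⟩
    value z
      ≡⟨ avgOver≡𝔼ᵤ n _ ⟩
    𝔼ᵤ n (λ x → fromℕ (lcsLen x z))
      ≡⟨ 𝔼-cong (allStrings n) (uniform n) (λ x → cong fromℕ (lcsLen-comm x z)) ⟩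
    𝔼ᵤ n (λ x → fromℕ (lcsLen z x))
      ≡⟨ cong (λ y → 𝔼ᵤ n (λ x → fromℕ (lcsLen y x))) v≡z ⟨
    𝔼ᵤ n (λ x → fromℕ (lcsLen (Vec.toList v) x)) ∎)
  where
  open ≡-Reasoning
  value : List Bool → ℚ
  value z = avgOver n (λ x → fromℕ (lcsLen x z))

traces-dependOnlyOn-⋃ : ∀ {t} (ms : Vec (List Bool) t) →
  DependsOnlyOn (⋃ ms) (λ x → Vec.map (applyMask x) ms)
traces-dependOnlyOn-⋃ ms x w |w| = map-applyMask-splice ms (⊑-⋃ ms)
  where
  map-applyMask-splice : ∀ {t} (ms′ : Vec (List Bool) t) → VecAll.All (_⊑ ⋃ ms) ms′ →
    Vec.map (applyMask (splice (⋃ ms) w x)) ms′ ≡ Vec.map (applyMask x) ms′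
  map-applyMask-splice Vec.[]          VecAll.[]          = refl
  map-applyMask-splice (m Vec.∷ ms′) (m⊑ VecAll.∷ ms′⊑) =
    cong₂ Vec._∷_ (applyMask-splice m (⋃ ms) w x m⊑ |w|) (map-applyMask-splice ms′ ms′⊑)

module _ (t n : ℕ) (δ : ℚ) where

  L0avg-achievable : Σ[ A ∈ Algorithm t n ] L0avg n ≤ algValue t δ n A
  L0avg-achievable = let v , L0≡ = L0avg-attained n in (λ _ → v) , QP.≤-reflexive (begin
    L0avg n
      ≡⟨ L0≡ ⟩
    𝔼ᵤ n (λ x → fromℕ (lcsLen (Vec.toList v) x))
      ≡⟨ 𝔼-cong (allStrings n) (uniform n) (λ x → 𝔼-const M (tupleProb δ) (∑-tupleProb δ t n) _) ⟨
    𝔼ᵤ n (λ x → 𝔼 M (tupleProb δ) (λ _ → fromℕ (lcsLen (Vec.toList v) x)))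
      ≡⟨ avgOver≡𝔼ᵤ n _ ⟨
    algValue t δ n (λ _ → v) ∎)
    where
    open ≡-Reasoning
    M : List (Vec (List Bool) t)
    M = allMaskTuples t n

  algValue≤L0avg+ : 0ℚ ≤ δ → 0ℚ ≤ 1ℚ - δ → (A : Algorithm t n) →
    algValue t δ n A ≤ L0avg n + fromℕ t * (1ℚ - δ) * fromℕ n
  algValue≤L0avg+ δ≥0 ρ≥0 A = begin
    algValue t δ n A
      ≡⟨ avgOver≡𝔼ᵤ n _ ⟩
    𝔼ᵤ n (λ x → 𝔼 M (tupleProb δ) (λ ms → lcs ms x))
      ≡⟨ 𝔼-comm (allStrings n) (uniform n) M (tupleProb δ) (λ x ms → lcs ms x) ⟩
    𝔼 M (tupleProb δ) (λ ms → 𝔼ᵤ n (lcs ms))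
      ≤⟨ 𝔼-mono M (tupleProb δ) (tupleProb-nonNeg δ δ≥0 ρ≥0) (λ ms _ → fixedMasks ms) ⟩
    𝔼 M (tupleProb δ) (λ ms → L0avg n + fromℕ (Vec.sum (Vec.map weight ms)))
      ≡⟨ 𝔼-distrib-+ M (tupleProb δ) (λ _ → L0avg n) _ ⟩
    𝔼 M (tupleProb δ) (λ _ → L0avg n) + 𝔼 M (tupleProb δ) (λ ms → fromℕ (Vec.sum (Vec.map weight ms)))
      ≡⟨ cong₂ _+_ (𝔼-const M (tupleProb δ) (∑-tupleProb δ t n) _) (𝔼-totalWeight δ t n) ⟩
    L0avg n + fromℕ t * (1ℚ - δ) * fromℕ n ∎
    where
    open QP.≤-Reasoning
    M : List (Vec (List Bool) t)
    M = allMaskTuples t n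
    output : Vec (List Bool) t → List Bool → List Bool
    output ms x = Vec.toList (A (Vec.map (applyMask x) ms))
    lcs : Vec (List Bool) t → List Bool → ℚ
    lcs ms x = fromℕ (lcsLen (output ms x) x)
    fixedMasks : ∀ ms → 𝔼ᵤ n (lcs ms) ≤ L0avg n + fromℕ (Vec.sum (Vec.map weight ms))
    fixedMasks ms = QP.≤-trans
      (𝔼ᵤ-lcsLen-dependsOnlyOn n (⋃ ms) (output ms) (L0avg n)
        (λ x w |w| → cong (λ ys → Vec.toList (A ys)) (traces-dependOnlyOn-⋃ ms x w |w|))
        (λ w → 𝔼ᵤ-lcsLen≤L0avg n (A (Vec.map (applyMask w) ms))))
      (QP.+-monoʳ-≤ (L0avg n) (fromℕ-mono (weight-⋃ ms)))

theorem5p1 : (n t : ℕ) → t ≥ 1 → (δ : ℚ) → 0ℚ < δ → δ < 1ℚ →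
    (Σ[ A ∈ Algorithm t n ] L0avg n ≤ algValue t δ n A)
    × ((A : Algorithm t n) → algValue t δ n A ≤ L0avg n + fromℕ t * (1ℚ - δ) * fromℕ n)
theorem5p1 n t _ δ 0<δ δ<1 = L0avg-achievable t n δ , algValue≤L0avg+ t n δ δ≥0 ρ≥0
  where
  δ≥0 : 0ℚ ≤ δ
  δ≥0 = QP.<⇒≤ 0<δ
  ρ≥0 : 0ℚ ≤ 1ℚ - δ
  ρ≥0 = QP.≤-trans (QP.≤-reflexive (sym (QP.+-inverseʳ δ))) (QP.+-monoˡ-≤ (- δ) (QP.<⇒≤ δ<1))
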